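{- If a $(v,k,\lambda)$-BIBD admits a $0$-LSE $\ell$-colouring with $\ell<v$, then $3\leq \ell\leq k$.
   Context: For positive integers $v,k,\lambda$ with $2\le k<v$, a $(v,k,\lambda)$-BIBD is a pair $(V,\mathcal{B})$ where $V$ is a set of $v$ points and $\mathcal{B}$ is a collection of $k$-element subsets of $V$ (blocks) such that every pair of distinct points lies in exactly $\lambda$ blocks. An $\ell$-colouring is a surjective map from $V$ onto a set of $\ell$ colours; the colour class of a colour is the set of points mapped to it. A $0$-LSE $\ell$-colouring is an $\ell$-colouring such that in each block $B$, some colour does not appear in $B$, and for any two colours other than that colour, with colour classes $C_1,C_2$, $\big||C_1\cap B|-|C_2\cap B|\big|\le 1$. Such a colouring is called nontrivial if $\ell<v$. -}

module Defs where

open import Data.Nat using (ℕ; suc; _≤_; _<_)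
open import Data.Fin using (Fin; _≟_)
open import Data.Fin.Subset using (Subset; _∈_; _∉_; _∩_; ∣_∣)
open import Data.Fin.Subset.Properties using (_∈?_)
open import Data.List using (List; length; filter)
open import Data.List.Relation.Unary.All using (All)
open import Data.Vec using (tabulate)
open import Data.Product using (Σ; _×_; ∃)
open import Relation.Nullary using (¬_; does)
open import Relation.Nullary.Decidable using (_×-dec_)
open import Relation.Binary.PropositionalEquality using (_≡_)

pairCount : ∀ {v} → List (Subset v) → Fin v → Fin v → ℕ
pairCount blocks x y = length (filter (λ B → (x ∈? B) ×-dec (y ∈? B)) blocks)

-- A (v,k,λ)-BIBD on the point set Fin v; blocks form a list (a multiset).
record IsBIBD (v k lam : ℕ) (blocks : List (Subset v)) : Set where
  field
    k≥2      : 2 ≤ k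
    k<v      : k < v
    λ-pos    : 1 ≤ lam
    blockSize : All (λ B → ∣ B ∣ ≡ k) blocks
    balanced : ∀ (x y : Fin v) → ¬ (x ≡ y) → pairCount blocks x y ≡ lam

Surjective : ∀ {v ℓ} → (Fin v → Fin ℓ) → Set
Surjective {v} {ℓ} c = ∀ (i : Fin ℓ) → ∃ λ (x : Fin v) → c x ≡ i

colourClass : ∀ {v ℓ} → (Fin v → Fin ℓ) → Fin ℓ → Subset v
colourClass c i = tabulate (λ x → does (c x ≟ i))

AbsDiff≤1 : ℕ → ℕ → Set
AbsDiff≤1 a b = (a ≤ suc b) × (b ≤ suc a)

LSE0Block : ∀ {v ℓ} → (Fin v → Fin ℓ) → Subset v → Set
LSE0Block {v} {ℓ} c B =
  Σ (Fin ℓ) λ a →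
    (∀ (x : Fin v) → x ∈ B → ¬ (c x ≡ a)) ×
    (∀ (i j : Fin ℓ) → ¬ (i ≡ a) → ¬ (j ≡ a) →
       AbsDiff≤1 ∣ colourClass c i ∩ B ∣ ∣ colourClass c j ∩ B ∣)

Is0LSE : ∀ {v ℓ} → List (Subset v) → (Fin v → Fin ℓ) → Set
Is0LSE blocks c = Surjective c × All (LSE0Block c) blocks

-- Since ℓ < v, two distinct points x, y share a colour, and some block B contains both.
-- In B that colour class has at least two points, so by the balance condition every colour
-- other than the one missing from B occurs in B; counting B minus y gives ℓ - 1 ≤ k - 1.
-- For ℓ ≤ 2 some block would contain every colour (the only one, or two points of different
-- colours), leaving no colour missing from it.
module Submission where

open import Defs
open import Data.Empty using (⊥-elim)
open import Data.Fin using (Fin; zero; suc; _≟_; punchIn)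
open import Data.Fin.Properties
  using (pigeonhole; suc-injective; 0≢1+n; <⇒≢; punchIn-injective; punchInᵢ≢i)
open import Data.Fin.Subset using (Subset; _∈_; _∩_; _-_; ∣_∣; Nonempty)
open import Data.Fin.Subset.Properties
  using (nonempty?; Empty-unique; ∣⊥∣≡0; x∈p⇒∣p-x∣<∣p∣; x∈p∧x≢y⇒x∈p-y; x∈p∩q⁺; x∈p∩q⁻)
open import Data.List using (List; _∷_; length; filter)
open import Data.List.Relation.Unary.All using (All; lookupAny; zip)
open import Data.List.Relation.Unary.Any using (Any; here; there)
open import Data.Nat using (ℕ; zero; suc; _≤_; _<_; z≤n; s≤s)
open import Data.Nat.Properties using (≤-trans; <-≤-trans; ≤-pred; <-irrefl)
open import Data.Product using (∃; _×_; _,_; proj₁; proj₂)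
open import Data.Vec.Properties using (lookup∘tabulate; []=⇒lookup; lookup⇒[]=)
open import Function using (_∘_)
open import Relation.Nullary using (¬_; yes; no)
open import Relation.Nullary.Decidable using (dec-true)
open import Relation.Unary using (Pred; Decidable)
open import Relation.Binary.PropositionalEquality using (_≡_; _≢_; refl; sym; trans; cong; subst)

∈-colourClass⁺ : ∀ {v ℓ} (c : Fin v → Fin ℓ) {i x} → c x ≡ i → x ∈ colourClass c i
∈-colourClass⁺ c {i} {x} cx≡i =
  lookup⇒[]= x _ (trans (lookup∘tabulate _ x) (dec-true (c x ≟ i) cx≡i))

∈-colourClass⁻ : ∀ {v ℓ} (c : Fin v → Fin ℓ) {i x} → x ∈ colourClass c i → c x ≡ i
∈-colourClass⁻ c {i} {x} x∈ with c x ≟ i | trans (sym (lookup∘tabulate _ x)) ([]=⇒lookup x∈)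
... | yes cx≡i | _ = cx≡i

x∈p⇒0<∣p∣ : ∀ {n} {p : Subset n} {x} → x ∈ p → 0 < ∣ p ∣
x∈p⇒0<∣p∣ x∈p = ≤-trans (s≤s z≤n) (x∈p⇒∣p-x∣<∣p∣ x∈p)

x∈p∧y∈p∧x≢y⇒1<∣p∣ : ∀ {n} {p : Subset n} {x y} → x ∈ p → y ∈ p → x ≢ y → 1 < ∣ p ∣
x∈p∧y∈p∧x≢y⇒1<∣p∣ x∈p y∈p x≢y =
  <-≤-trans (s≤s (x∈p⇒0<∣p∣ (x∈p∧x≢y⇒x∈p-y y∈p (λ y≡x → x≢y (sym y≡x))))) (x∈p⇒∣p-x∣<∣p∣ x∈p)

0<∣p∣⇒Nonempty : ∀ {n} (p : Subset n) → 0 < ∣ p ∣ → Nonempty p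
0<∣p∣⇒Nonempty {n} p 0<∣p∣ with nonempty? p
... | yes p≢∅ = p≢∅
... | no p≡∅ =
  ⊥-elim (<-irrefl refl (subst (0 <_) (trans (cong ∣_∣ (Empty-unique p≡∅)) (∣⊥∣≡0 n)) 0<∣p∣))

injective⇒≤∣p∣ : ∀ {m n} (f : Fin m → Fin n) → (∀ {i j} → f i ≡ f j → i ≡ j) →
                 (p : Subset n) → (∀ i → f i ∈ p) → m ≤ ∣ p ∣
injective⇒≤∣p∣ {zero}  f inj p f∈p = z≤n
injective⇒≤∣p∣ {suc m} f inj p f∈p =
  <-≤-trans (s≤s (injective⇒≤∣p∣ (λ i → f (suc i)) (λ eq → suc-injective (inj eq)) (p - f zero)
                    (λ i → x∈p∧x≢y⇒x∈p-y (f∈p (suc i)) (λ eq → 0≢1+n (inj (sym eq))))))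
            (x∈p⇒∣p-x∣<∣p∣ (f∈p zero))

filter-nonempty⇒Any : ∀ {a p} {A : Set a} {P : Pred A p} (P? : Decidable P) (xs : List A) →
                      0 < length (filter P? xs) → Any P xs
filter-nonempty⇒Any P? (x ∷ xs) 0<len with P? x
... | yes px = here px
... | no _   = there (filter-nonempty⇒Any P? xs 0<len)

allButOne-represented⇒≤1+∣S∣ : ∀ {v ℓ} (c : Fin v → Fin ℓ) (a : Fin ℓ) (S : Subset v) →
  (∀ j → j ≢ a → ∃ λ z → z ∈ S × c z ≡ j) → ℓ ≤ suc ∣ S ∣
allButOne-represented⇒≤1+∣S∣ {ℓ = suc n} c a S represented =
  s≤s (injective⇒≤∣p∣ (proj₁ ∘ rep) rep-injective S (proj₁ ∘ proj₂ ∘ rep))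
  where
  rep : (j : Fin n) → ∃ λ z → z ∈ S × c z ≡ punchIn a j
  rep j = represented (punchIn a j) (punchInᵢ≢i a j)

  rep-injective : ∀ {i j} → proj₁ (rep i) ≡ proj₁ (rep j) → i ≡ j
  rep-injective {i} {j} eq = punchIn-injective a i j
    (trans (sym (proj₂ (proj₂ (rep i)))) (trans (cong c eq) (proj₂ (proj₂ (rep j)))))

module _ {v ℓ} (c : Fin v → Fin ℓ) where

  allColours⇒¬LSE0Block : ∀ {B} → (∀ i → ∃ λ z → z ∈ B × c z ≡ i) → ¬ LSE0Block c B
  allColours⇒¬LSE0Block hit (a , miss , _) with hit a
  ... | z , z∈B , cz≡a = miss z z∈B cz≡a

  missingColour : ∀ {B} → LSE0Block c B → Fin ℓ
  missingColour = proj₁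

  LSE0Block-twice⇒meetsAll : ∀ {B} (lse : LSE0Block c B) {i j} →
    i ≢ missingColour lse → 1 < ∣ colourClass c i ∩ B ∣ →
    j ≢ missingColour lse → Nonempty (colourClass c j ∩ B)
  LSE0Block-twice⇒meetsAll (a , _ , balance) {i} {j} i≢a twice j≢a =
    0<∣p∣⇒Nonempty _ (≤-pred (≤-trans twice (proj₁ (balance i j i≢a j≢a))))

  LSE0Block-pair⇒allButMissing-represented : ∀ {B} (lse : LSE0Block c B) {x y} →
    x ∈ B → y ∈ B → x ≢ y → c x ≡ c y →
    ∀ j → j ≢ missingColour lse → ∃ λ z → z ∈ B - y × c z ≡ j
  LSE0Block-pair⇒allButMissing-represented {B} lse@(_ , miss , _) {x} {y} x∈B y∈B x≢y cx≡cy j j≢a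
    with c x ≟ j
  ... | yes cx≡j = x , x∈p∧x≢y⇒x∈p-y x∈B x≢y , cx≡j
  ... | no cx≢j with LSE0Block-twice⇒meetsAll lse (miss x x∈B) twice j≢a
    where
    twice : 1 < ∣ colourClass c (c x) ∩ B ∣
    twice = x∈p∧y∈p∧x≢y⇒1<∣p∣ (x∈p∩q⁺ (∈-colourClass⁺ c refl , x∈B))
                                (x∈p∩q⁺ (∈-colourClass⁺ c (sym cx≡cy) , y∈B)) x≢y
  ... | z , z∈Cj∩B with x∈p∩q⁻ _ _ z∈Cj∩B
  ... | z∈Cj , z∈B = z , x∈p∧x≢y⇒x∈p-y z∈B z≢y , ∈-colourClass⁻ c z∈Cj
    where
    z≢y : z ≢ y
    z≢y refl = cx≢j (trans cx≡cy (∈-colourClass⁻ c z∈Cj))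

  LSE0Block-pair⇒ℓ≤∣B∣ : ∀ {B} → LSE0Block c B → ∀ {x y} →
    x ∈ B → y ∈ B → x ≢ y → c x ≡ c y → ℓ ≤ ∣ B ∣
  LSE0Block-pair⇒ℓ≤∣B∣ lse x∈B y∈B x≢y cx≡cy =
    ≤-trans (allButOne-represented⇒≤1+∣S∣ c (missingColour lse) _
              (LSE0Block-pair⇒allButMissing-represented lse x∈B y∈B x≢y cx≡cy))
            (x∈p⇒∣p-x∣<∣p∣ y∈B)

module _ {v k lam} {blocks : List (Subset v)} (bibd : IsBIBD v k lam blocks) where
  open IsBIBD bibd

  blockThrough : ∀ {r} {R : Pred (Subset v) r} → All R blocks → ∀ {x y} → x ≢ y →
                 ∃ λ B → R B × x ∈ B × y ∈ B
  blockThrough allR {x} {y} x≢y =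
    let inBoth = filter-nonempty⇒Any _ blocks (subst (0 <_) (sym (balanced x y x≢y)) λ-pos)
    in _ , lookupAny allR inBoth

  0LSE⇒3≤ℓ : ∀ {ℓ} (c : Fin v → Fin ℓ) → Is0LSE blocks c → ∀ {x y : Fin v} → x ≢ y → 3 ≤ ℓ
  0LSE⇒3≤ℓ {zero} c _ {x} _ with () ← c x
  0LSE⇒3≤ℓ {1} c (_ , lse) {x} x≢y with B , lseB , x∈B , _ ← blockThrough lse x≢y =
    ⊥-elim (allColours⇒¬LSE0Block c hit lseB)
    where
    hit : ∀ i → ∃ λ z → z ∈ B × c z ≡ i
    hit zero = x , x∈B , Fin1-unique (c x)
      where
      Fin1-unique : (i : Fin 1) → i ≡ zero
      Fin1-unique zero = refl
  0LSE⇒3≤ℓ {2} c (surj , lse) _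
    with x , cx≡0 ← surj zero | y , cy≡1 ← surj (suc zero)
    with B , lseB , x∈B , y∈B ← blockThrough lse
                                  (λ x≡y → 0≢1+n (trans (sym cx≡0) (trans (cong c x≡y) cy≡1)))
    = ⊥-elim (allColours⇒¬LSE0Block c hit lseB)
    where
    hit : ∀ i → ∃ λ z → z ∈ B × c z ≡ i
    hit zero       = x , x∈B , cx≡0
    hit (suc zero) = y , y∈B , cy≡1
  0LSE⇒3≤ℓ {suc (suc (suc _))} _ _ _ = s≤s (s≤s (s≤s z≤n))

theorem3p3 : ∀ (v k lam ℓ : ℕ) (blocks : List (Subset v)) → IsBIBD v k lam blocks →
    (c : Fin v → Fin ℓ) → Is0LSE blocks c → ℓ < v → (3 ≤ ℓ) × (ℓ ≤ k)
theorem3p3 v k lam ℓ blocks bibd c (surj , lse) ℓ<v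
  with x , y , x<y , cx≡cy ← pigeonhole ℓ<v c
  with B , (∣B∣≡k , lseB) , x∈B , y∈B
         ← blockThrough bibd (zip (IsBIBD.blockSize bibd , lse)) (<⇒≢ x<y)
  = 0LSE⇒3≤ℓ bibd c (surj , lse) (<⇒≢ x<y)
  , subst (ℓ ≤_) ∣B∣≡k (LSE0Block-pair⇒ℓ≤∣B∣ c lseB x∈B y∈B (<⇒≢ x<y) cx≡cy)
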